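{- Let $G$ be a (finite, simple) graph and let $k$ be a non-negative integer with $k\leq\mu(G)$. Then there exists a graph $H$ such that $G$ is a subgraph of $H$, the independence polynomial $I(H;x)$ is symmetric, and \[ I(G\circ 2K_{1};x)=(1+x)^{k}\cdot I(H;x). \]
   Context: All graphs are finite, simple and undirected. For a graph $G$, $\mu(G)$ is the maximum cardinality of a matching (set of pairwise non-incident edges). If $s_k$ denotes the number of independent sets (sets of pairwise non-adjacent vertices) of size $k$ in $G$ and $\alpha=\alpha(G)$ is the maximum size of an independent set, the independence polynomial is $I(G;x)=\sum_{k=0}^{\alpha}s_kx^k$ (with $s_0=1$). It is called symmetric (palindromic) if $s_j=s_{\alpha-j}$ for $0\leq j\leq\lfloor\alpha/2\rfloor$. $2K_1$ denotes the graph consisting of two non-adjacent vertices, and $G\circ 2K_1$ (the corona) is the graph obtained from $G$ by adding, for each vertex $v$ of $G$, two new non-adjacent vertices joined only to $v$. -}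

module Defs where

open import Data.Bool using (Bool; true; false; _∧_; _∨_; not; if_then_else_)
open import Data.Nat using (ℕ; zero; suc; _+_; _*_; _∸_; _≤_; _≡ᵇ_; ⌊_/2⌋; _⊔_)
open import Data.Nat.Combinatorics using (_C_)
open import Data.Fin using (Fin; splitAt; toℕ)
open import Data.Fin.Properties using (_≟_)
open import Data.Fin.Subset using (Subset; ∣_∣)
open import Data.Vec using (Vec; []; _∷_; lookup)
open import Data.List using (List; []; _∷_; map; _++_; filter; length; foldr; upTo; concatMap; allFin)
open import Data.Bool.ListAction using (and)
open import Data.Nat.ListAction using (sum)
open import Data.List.Relation.Unary.All using (All)
open import Data.List.Relation.Unary.Unique.Propositional using (Unique)
open import Data.Sum using (_⊎_; inj₁; inj₂)
open import Data.Product using (_×_; _,_; Σ; ∃; proj₁; proj₂)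
open import Function using (_∘_)
open import Function.Definitions using (Injective)
open import Relation.Nullary.Decidable using (⌊_⌋; yes; no)
open import Data.Empty using (⊥-elim)
open import Relation.Binary.PropositionalEquality using (_≡_; refl)

record Graph : Set where
  field
    n      : ℕ
    adj    : Fin n → Fin n → Bool
    sym    : ∀ u v → adj u v ≡ adj v u
    irrefl : ∀ v → adj v v ≡ false
open Graph public

-- Subgraph (up to isomorphism): an injective vertex map preserving edges.

_⊆G_ : Graph → Graph → Set
G ⊆G H = Σ (Fin (n G) → Fin (n H)) λ f →
  Injective _≡_ _≡_ f × (∀ u v → adj G u v ≡ true → adj H (f u) (f v) ≡ true)

subsets : (m : ℕ) → List (Subset m)
subsets zero    = [] ∷ []
subsets (suc m) = map (false ∷_) (subsets m) ++ map (true ∷_) (subsets m)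

isIndependent : (G : Graph) → Subset (n G) → Bool
isIndependent G S =
  and (concatMap (λ u → map (λ v → not (lookup S u ∧ lookup S v ∧ adj G u v)) (allFin (n G)))
                 (allFin (n G)))

independentSets : (G : Graph) → List (Subset (n G))
independentSets G = filter (λ S → isIndependent G S Data.Bool.≟ true) (subsets (n G))

indCoeff : Graph → ℕ → ℕ
indCoeff G k = length (filter (λ S → ∣ S ∣ Data.Nat.≟ k) (independentSets G))

indepNumber : Graph → ℕ
indepNumber G = foldr (λ S m → ∣ S ∣ ⊔ m) 0 (independentSets G)

Symmetric : Graph → Set
Symmetric G = ∀ j → j ≤ ⌊ indepNumber G /2⌋ →
  indCoeff G j ≡ indCoeff G (indepNumber G ∸ j)

Poly : Set
Poly = ℕ → ℕ

_⊛_ : Poly → Poly → Poly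
(p ⊛ q) j = sum (map (λ i → p i * q (j ∸ i)) (upTo (suc j)))

onePlusXPow : ℕ → Poly
onePlusXPow k i = k C i

indPoly : Graph → Poly
indPoly = indCoeff

IsMatching : (G : Graph) → List (Fin (n G) × Fin (n G)) → Set
IsMatching G M =
  All (λ e → adj G (proj₁ e) (proj₂ e) ≡ true) M ×
  Unique (concatMap (λ e → proj₁ e ∷ proj₂ e ∷ []) M)

IsMatchingNumber : Graph → ℕ → Set
IsMatchingNumber G m =
  (Σ (List (Fin (n G) × Fin (n G))) λ M → IsMatching G M × length M ≡ m) ×
  (∀ M → IsMatching G M → length M ≤ m)

-- The corona G ∘ 2K₁: vertex set Fin (n + (n + n)); block 0 is G,
-- blocks 1 and 2 contain the two pendant copies v', v'' of each v.

data Part (m : ℕ) : Set where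
  core  : Fin m → Part m
  leaf₁ : Fin m → Part m
  leaf₂ : Fin m → Part m

part : ∀ {m} → Fin (m + (m + m)) → Part m
part {m} x with splitAt m x
... | inj₁ u = core u
... | inj₂ y with splitAt m y
...   | inj₁ u = leaf₁ u
...   | inj₂ u = leaf₂ u

coronaAdj′ : (G : Graph) → Part (n G) → Part (n G) → Bool
coronaAdj′ G (core u)  (core v)  = adj G u v
coronaAdj′ G (core u)  (leaf₁ v) = ⌊ u ≟ v ⌋
coronaAdj′ G (core u)  (leaf₂ v) = ⌊ u ≟ v ⌋
coronaAdj′ G (leaf₁ u) (core v)  = ⌊ u ≟ v ⌋
coronaAdj′ G (leaf₂ u) (core v)  = ⌊ u ≟ v ⌋
coronaAdj′ G (leaf₁ u) (leaf₁ v) = false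
coronaAdj′ G (leaf₁ u) (leaf₂ v) = false
coronaAdj′ G (leaf₂ u) (leaf₁ v) = false
coronaAdj′ G (leaf₂ u) (leaf₂ v) = false

private
  ≟-sym : ∀ {m} (u v : Fin m) → ⌊ u ≟ v ⌋ ≡ ⌊ v ≟ u ⌋
  ≟-sym u v with u ≟ v | v ≟ u
  ... | yes _ | yes _ = refl
  ... | no _  | no _  = refl
  ... | yes refl | no ¬p = ⊥-elim (¬p refl)
  ... | no ¬p | yes refl = ⊥-elim (¬p refl)

  coronaSym : (G : Graph) → ∀ a b → coronaAdj′ G a b ≡ coronaAdj′ G b a
  coronaSym G (core u)  (core v)  = sym G u v
  coronaSym G (core u)  (leaf₁ v) = ≟-sym u v
  coronaSym G (core u)  (leaf₂ v) = ≟-sym u v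
  coronaSym G (leaf₁ u) (core v)  = ≟-sym u v
  coronaSym G (leaf₂ u) (core v)  = ≟-sym u v
  coronaSym G (leaf₁ u) (leaf₁ v) = refl
  coronaSym G (leaf₁ u) (leaf₂ v) = refl
  coronaSym G (leaf₂ u) (leaf₁ v) = refl
  coronaSym G (leaf₂ u) (leaf₂ v) = refl

  coronaIrr : (G : Graph) → ∀ a → coronaAdj′ G a a ≡ false
  coronaIrr G (core u)  = irrefl G u
  coronaIrr G (leaf₁ u) = refl
  coronaIrr G (leaf₂ u) = refl

corona2K1 : Graph → Graph
corona2K1 G = record
  { n      = n G + (n G + n G)
  ; adj    = λ x y → coronaAdj′ G (part x) (part y)
  ; sym    = λ x y → coronaSym G (part x) (part y)
  ; irrefl = λ x → coronaIrr G (part x)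
  }

module Submission where

-- Extend G by b pairwise non-adjacent new vertices, the e-th adjacent exactly
-- to a set N e of old vertices.  An independent set of the extension is S ∪ T
-- with S independent in G and T a set of new vertices whose neighbourhoods
-- miss S ("free" for S), so
--     I(extension; x) = Σ_{S independent in G} x^|S| (1+x)^|free S|.     (★)
-- Call the extension balanced if every independent S meets exactly 2|S| new
-- vertices; then |free S| + 2|S| = b, each term of (★) is palindromic of degree
-- b, α = b (attained by all new vertices), and I is symmetric.
--   * The corona G ∘ 2K₁ is a balanced extension with b = 2n.
--   * Given a matching L, the padded graph H adds one vertex adjacent to both
--     ends of each edge of L and 2 − (edges of L at u) pendant vertices at
--     each u; it is balanced with b = 2n − |L|.
-- Comparing (★) for both graphs term by term gives the factor (1+x)^|L|, and
-- the theorem follows by taking for L the first k edges of a maximum matching.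

open import Defs
open import Level using (Level)
open import Function using (_∘_; id; case_of_)
open import Data.Empty using (⊥; ⊥-elim)
open import Data.Product using (Σ; _×_; _,_; proj₁; proj₂; ∃)
open import Data.Sum using (_⊎_; inj₁; inj₂)
open import Relation.Nullary using (does; yes; no; ¬_)
open import Relation.Nullary.Decidable using (isYes≗does)
open import Relation.Unary using (Pred; Decidable)
open import Relation.Binary.PropositionalEquality
  using (_≡_; refl; cong; cong₂; trans; subst; module ≡-Reasoning) renaming (sym to ≡-sym)

open import Data.Bool using (Bool; true; false; _∧_; _∨_; not)
import Data.Bool as Bool
open import Data.Bool.Properties
  using (∧-conicalˡ; ∧-conicalʳ; ∧-assoc; ∧-zeroʳ; ∨-zeroʳ; ∧-distribˡ-∨; not-injective; ¬-not)
open import Data.Bool.ListAction using (and; or)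

open import Data.Nat using (ℕ; zero; suc; _+_; _*_; _∸_; _⊔_; _⊓_; _≤_; _<_; z≤n; s≤s)
open import Data.Nat.Properties
open import Data.Nat.Tactic.RingSolver using (solve-∀)
open import Data.Nat.Combinatorics using (_C_; nCk+nC[k+1]≡[n+1]C[k+1]; k>n⇒nCk≡0; nCk≡nC[n∸k])
open import Data.Nat.ListAction using (sum)

open import Data.Fin using (Fin; zero; suc; _↑ˡ_; _↑ʳ_; splitAt; join)
open import Data.Fin.Properties
  using (join-splitAt; ↑ˡ-injective; splitAt-↑ˡ; splitAt-↑ʳ) renaming (_≟_ to _≟ᶠ_)
open import Data.Fin.Subset using (Subset; ∣_∣) renaming (⊥ to ∅)
open import Data.Fin.Subset.Properties using (∣⊥∣≡0)

open import Data.Vec using ([]; _∷_; lookup)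
import Data.Vec as Vec
open import Data.Vec.Properties
  using (tabulate∘lookup; lookup∘tabulate; lookup-++ˡ; lookup-++ʳ; lookup-replicate)

open import Data.List
  using (List; []; _∷_; map; _++_; filter; length; concatMap; replicate; allFin; upTo; tabulate; foldr; take; drop)
import Data.List as List
open import Data.List.Properties
  using (map-upTo; map-tabulate; length-tabulate; map-cong; length-take; take++drop≡id; concatMap-++)
open import Data.List.Membership.Propositional using (_∈_)
open import Data.List.Membership.Propositional.Properties
  using (∈-allFin; ∈-map⁺; ∈-++⁺ˡ; ∈-++⁺ʳ; ∈-filter⁺; ∈-filter⁻)
open import Data.List.Relation.Unary.Any using (here; there)
open import Data.List.Relation.Unary.All using (All; []; _∷_)
import Data.List.Relation.Unary.All.Properties as All
open import Data.List.Relation.Unary.AllPairs using ([]; _∷_)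
open import Data.List.Relation.Unary.Unique.Propositional using (Unique)

private
  variable
    a : Level
    A B : Set a

𝟙 : Bool → ℕ
𝟙 true  = 1
𝟙 false = 0

∑ : List A → (A → ℕ) → ℕ
∑ []       f = 0
∑ (x ∷ xs) f = f x + ∑ xs f

syntax ∑ xs (λ x → e) = ∑[ x ← xs ] e

∑-cong : ∀ (xs : List A) {f g : A → ℕ} → (∀ x → f x ≡ g x) → ∑ xs f ≡ ∑ xs g
∑-cong []       f≗g = refl
∑-cong (x ∷ xs) f≗g = cong₂ _+_ (f≗g x) (∑-cong xs f≗g)

∑-cong-All : ∀ {P : A → Set} (xs : List A) {f g : A → ℕ} →
  All P xs → (∀ x → P x → f x ≡ g x) → ∑ xs f ≡ ∑ xs g
∑-cong-All []       []         f≗g = refl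
∑-cong-All (x ∷ xs) (px ∷ pxs) f≗g = cong₂ _+_ (f≗g x px) (∑-cong-All xs pxs f≗g)

∑-+ : ∀ (xs : List A) (f g : A → ℕ) → ∑[ x ← xs ] (f x + g x) ≡ ∑ xs f + ∑ xs g
∑-+ []       f g = refl
∑-+ (x ∷ xs) f g = trans (cong (f x + g x +_) (∑-+ xs f g)) (interchange (f x) (g x) _ _)
  where
  interchange : ∀ p q r s → (p + q) + (r + s) ≡ (p + r) + (q + s)
  interchange = solve-∀

∑-*ˡ : ∀ (xs : List A) c (f : A → ℕ) → ∑[ x ← xs ] (c * f x) ≡ c * ∑ xs f
∑-*ˡ []       c f = ≡-sym (*-zeroʳ c)
∑-*ˡ (x ∷ xs) c f = trans (cong (c * f x +_) (∑-*ˡ xs c f)) (≡-sym (*-distribˡ-+ c (f x) (∑ xs f)))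

∑-zero : ∀ (xs : List A) → ∑[ x ← xs ] 0 ≡ 0
∑-zero []       = refl
∑-zero (x ∷ xs) = ∑-zero xs

∑-one : ∀ (xs : List A) → ∑[ x ← xs ] 1 ≡ length xs
∑-one []       = refl
∑-one (x ∷ xs) = cong suc (∑-one xs)

∑-++ : ∀ (xs ys : List A) (f : A → ℕ) → ∑ (xs ++ ys) f ≡ ∑ xs f + ∑ ys f
∑-++ []       ys f = refl
∑-++ (x ∷ xs) ys f = trans (cong (f x +_) (∑-++ xs ys f)) (≡-sym (+-assoc (f x) (∑ xs f) (∑ ys f)))

∑-map : ∀ (g : A → B) (xs : List A) (f : B → ℕ) → ∑ (map g xs) f ≡ ∑ xs (f ∘ g)
∑-map g []       f = refl
∑-map g (x ∷ xs) f = cong (f (g x) +_) (∑-map g xs f)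

∑-concatMap : ∀ (g : A → List B) (xs : List A) (f : B → ℕ) →
  ∑ (concatMap g xs) f ≡ ∑[ x ← xs ] ∑ (g x) f
∑-concatMap g []       f = refl
∑-concatMap g (x ∷ xs) f = trans (∑-++ (g x) (concatMap g xs) f) (cong (∑ (g x) f +_) (∑-concatMap g xs f))

∑-replicate : ∀ c (x : A) (f : A → ℕ) → ∑ (replicate c x) f ≡ c * f x
∑-replicate zero    x f = refl
∑-replicate (suc c) x f = cong (f x +_) (∑-replicate c x f)

length-filter-filter : ∀ {P Q : Pred A a} (P? : Decidable P) (Q? : Decidable Q) (xs : List A) →
  length (filter P? (filter Q? xs)) ≡ ∑[ x ← xs ] 𝟙 (does (Q? x) ∧ does (P? x))
length-filter-filter P? Q? [] = refl
length-filter-filter P? Q? (x ∷ xs) with does (Q? x)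
... | false = length-filter-filter P? Q? xs
... | true with does (P? x)
...   | false = length-filter-filter P? Q? xs
...   | true  = cong suc (length-filter-filter P? Q? xs)

∑-subsets-++ : ∀ m b (f : Subset (m + b) → ℕ) →
  ∑ (subsets (m + b)) f ≡ ∑[ S ← subsets m ] ∑[ T ← subsets b ] f (S Vec.++ T)
∑-subsets-++ zero    b f = ≡-sym (+-identityʳ _)
∑-subsets-++ (suc m) b f = begin
    ∑ (map (false ∷_) (subsets (m + b)) ++ map (true ∷_) (subsets (m + b))) f
  ≡⟨ ∑-++ (map (false ∷_) (subsets (m + b))) _ f ⟩
    ∑ (map (false ∷_) (subsets (m + b))) f + ∑ (map (true ∷_) (subsets (m + b))) f
  ≡⟨ cong₂ _+_ (half false) (half true) ⟩
    ∑ (map (false ∷_) (subsets m)) F + ∑ (map (true ∷_) (subsets m)) F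
  ≡⟨ ≡-sym (∑-++ (map (false ∷_) (subsets m)) _ F) ⟩
    ∑ (subsets (suc m)) F
  ∎
  where
  open ≡-Reasoning
  F : Subset (suc m) → ℕ
  F S = ∑[ T ← subsets b ] f (S Vec.++ T)
  half : ∀ c → ∑ (map (c ∷_) (subsets (m + b))) f ≡ ∑ (map (c ∷_) (subsets m)) F
  half c = begin
      ∑ (map (c ∷_) (subsets (m + b))) f
    ≡⟨ ∑-map (c ∷_) (subsets (m + b)) f ⟩
      ∑ (subsets (m + b)) (f ∘ (c ∷_))
    ≡⟨ ∑-subsets-++ m b (f ∘ (c ∷_)) ⟩
      ∑[ S ← subsets m ] F (c ∷ S)
    ≡⟨ ≡-sym (∑-map (c ∷_) (subsets m) F) ⟩
      ∑ (map (c ∷_) (subsets m)) F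
    ∎

-- The polynomial x^s (1+x)^F, as a coefficient sequence.
shiftedBinomial : ℕ → ℕ → Poly
shiftedBinomial F zero    j       = F C j
shiftedBinomial F (suc s) zero    = 0
shiftedBinomial F (suc s) (suc j) = shiftedBinomial F s j

shiftedBinomial-pascal : ∀ F s j →
  shiftedBinomial (suc F) s j ≡ shiftedBinomial F s j + shiftedBinomial F (suc s) j
shiftedBinomial-pascal F zero    zero    = refl
shiftedBinomial-pascal F zero    (suc j) =
  trans (≡-sym (nCk+nC[k+1]≡[n+1]C[k+1] F j)) (+-comm (F C j) (F C suc j))
shiftedBinomial-pascal F (suc s) zero    = refl
shiftedBinomial-pascal F (suc s) (suc j) = shiftedBinomial-pascal F s j

shiftedBinomial-monomial : ∀ s j → shiftedBinomial 0 s j ≡ 𝟙 (does (s + 0 ≟ j))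
shiftedBinomial-monomial zero    zero    = refl
shiftedBinomial-monomial zero    (suc j) = refl
shiftedBinomial-monomial (suc s) zero    = refl
shiftedBinomial-monomial (suc s) (suc j) = shiftedBinomial-monomial s j

shiftedBinomial-below : ∀ F s j → j < s → shiftedBinomial F s j ≡ 0
shiftedBinomial-below F (suc s) zero    _         = refl
shiftedBinomial-below F (suc s) (suc j) (s≤s j<s) = shiftedBinomial-below F s j j<s

shiftedBinomial-above : ∀ F s r → shiftedBinomial F s (s + r) ≡ F C r
shiftedBinomial-above F zero    r = refl
shiftedBinomial-above F (suc s) r = shiftedBinomial-above F s r

-- A coefficient of x^s (1+x)^F whose mirror image about degree F + 2s lies
-- below s vanishes: it lies above degree F + s.
shiftedBinomial-beyond : ∀ F s j w → j < s → j + w ≡ F + s + s → shiftedBinomial F s w ≡ 0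
shiftedBinomial-beyond F s j w j<s j+w≡ with s ≤? w
... | no  s≰w = shiftedBinomial-below F s w (≰⇒> s≰w)
... | yes s≤w with m≤n⇒∃[o]m+o≡n s≤w
... | r , refl = trans (shiftedBinomial-above F s r) (k>n⇒nCk≡0 F<r)
  where
  F<r : F < r
  F<r = +-cancelˡ-< s F r (+-cancelˡ-< j (s + F) (s + r) (begin-strict
      j + (s + F)  <⟨ +-monoˡ-< (s + F) j<s ⟩
      s + (s + F)  ≡⟨ rearrange s F ⟩
      F + s + s    ≡⟨ ≡-sym j+w≡ ⟩
      j + (s + r)  ∎))
    where
    open ≤-Reasoning
    rearrange : ∀ s F → s + (s + F) ≡ F + s + s
    rearrange = solve-∀

shiftedBinomial-palindromic : ∀ F s j w → j + w ≡ F + s + s →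
  shiftedBinomial F s j ≡ shiftedBinomial F s w
shiftedBinomial-palindromic F s j w j+w≡ with s ≤? j | s ≤? w
... | no s≰j | _ = trans (shiftedBinomial-below F s j (≰⇒> s≰j))
                         (≡-sym (shiftedBinomial-beyond F s j w (≰⇒> s≰j) j+w≡))
... | yes _ | no s≰w = trans (shiftedBinomial-beyond F s w j (≰⇒> s≰w) (trans (+-comm w j) j+w≡))
                             (≡-sym (shiftedBinomial-below F s w (≰⇒> s≰w)))
... | yes s≤j | yes s≤w with m≤n⇒∃[o]m+o≡n s≤j | m≤n⇒∃[o]m+o≡n s≤w
... | r , refl | r' , refl = begin
    shiftedBinomial F s (s + r)   ≡⟨ shiftedBinomial-above F s r ⟩
    F C r                         ≡⟨ nCk≡nC[n∸k] (subst (r ≤_) r+r'≡F (m≤m+n r r')) ⟩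
    F C (F ∸ r)                   ≡⟨ cong (F C_) (trans (cong (_∸ r) (≡-sym r+r'≡F)) (m+n∸m≡n r r')) ⟩
    F C r'                        ≡⟨ ≡-sym (shiftedBinomial-above F s r') ⟩
    shiftedBinomial F s (s + r')  ∎
  where
  open ≡-Reasoning
  rearrange : ∀ s r r' → r + r' + (s + s) ≡ s + r + (s + r')
  rearrange = solve-∀
  r+r'≡F : r + r' ≡ F
  r+r'≡F = +-cancelʳ-≡ (s + s) (r + r') F (trans (rearrange s r r') (trans j+w≡ (+-assoc F s s)))

_⊆ᵇ_ : ∀ {m} → Subset m → Subset m → Bool
[]      ⊆ᵇ []      = true
(t ∷ T) ⊆ᵇ (f ∷ F) = (not t ∨ f) ∧ (T ⊆ᵇ F)

count-subsets-of : ∀ b (F : Subset b) s j →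
  ∑[ T ← subsets b ] 𝟙 (T ⊆ᵇ F ∧ does (s + (∣ T ∣) ≟ j)) ≡ shiftedBinomial (∣ F ∣) s j
count-subsets-of zero    []      s j = trans (+-identityʳ _) (≡-sym (shiftedBinomial-monomial s j))
count-subsets-of (suc b) (f ∷ F) s j = begin
    ∑ (map (false ∷_) (subsets b) ++ map (true ∷_) (subsets b)) term
  ≡⟨ ∑-++ (map (false ∷_) (subsets b)) _ term ⟩
    ∑ (map (false ∷_) (subsets b)) term + ∑ (map (true ∷_) (subsets b)) term
  ≡⟨ cong₂ _+_ (trans (∑-map _ (subsets b) term) (count-subsets-of b F s j))
               (trans (∑-map _ (subsets b) term) (∑-cong (subsets b) λ T →
                  cong (λ i → 𝟙 ((f ∧ T ⊆ᵇ F) ∧ does (i ≟ j))) (+-suc s (∣ T ∣)))) ⟩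
    shiftedBinomial (∣ F ∣) s j + ∑[ T ← subsets b ] 𝟙 ((f ∧ T ⊆ᵇ F) ∧ does (suc s + (∣ T ∣) ≟ j))
  ≡⟨ add-element f ⟩
    shiftedBinomial (∣ f ∷ F ∣) s j
  ∎
  where
  open ≡-Reasoning
  term : Subset (suc b) → ℕ
  term T = 𝟙 (T ⊆ᵇ (f ∷ F) ∧ does (s + (∣ T ∣) ≟ j))
  add-element : ∀ f →
    shiftedBinomial (∣ F ∣) s j + (∑[ T ← subsets b ] 𝟙 ((f ∧ T ⊆ᵇ F) ∧ does (suc s + (∣ T ∣) ≟ j)))
      ≡ shiftedBinomial (∣ f ∷ F ∣) s j
  add-element true  = trans (cong (shiftedBinomial (∣ F ∣) s j +_) (count-subsets-of b F (suc s) j))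
                            (≡-sym (shiftedBinomial-pascal (∣ F ∣) s j))
  add-element false = trans (cong (shiftedBinomial (∣ F ∣) s j +_) (∑-zero (subsets b))) (+-identityʳ _)

combination : List A → (w F s : A → ℕ) → Poly
combination xs w F s j = ∑[ x ← xs ] (w x * shiftedBinomial (F x) (s x) j)

∑-𝟙-cong : ∀ (xs : List A) (p : A → Bool) {f g : A → ℕ} → (∀ x → p x ≡ true → f x ≡ g x) →
  ∑[ x ← xs ] (𝟙 (p x) * f x) ≡ ∑[ x ← xs ] (𝟙 (p x) * g x)
∑-𝟙-cong xs p f≗g = ∑-cong xs term
  where
  term : ∀ x → 𝟙 (p x) * _ ≡ 𝟙 (p x) * _
  term x with p x in px
  ... | true  = cong (1 *_) (f≗g x px)
  ... | false = refl

sum-map : ∀ (f : A → ℕ) (xs : List A) → sum (map f xs) ≡ ∑ xs f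
sum-map f []       = refl
sum-map f (x ∷ xs) = cong (f x +_) (sum-map f xs)

∑-upTo-suc : ∀ n (f : ℕ → ℕ) → ∑ (upTo (suc n)) f ≡ f 0 + ∑[ i ← upTo n ] (f (suc i))
∑-upTo-suc n f = cong (f 0 +_) (trans (cong (λ is → ∑ is f) (≡-sym (map-upTo suc n))) (∑-map suc (upTo n) f))

⊛-coefficient : ∀ (p q : Poly) j →
  (p ⊛ q) j ≡ p 0 * q j + ∑[ i ← upTo j ] (p (suc i) * q (j ∸ suc i))
⊛-coefficient p q j = trans (sum-map _ (upTo (suc j))) (∑-upTo-suc j (λ i → p i * q (j ∸ i)))

⊛-unit : ∀ (q : Poly) j → (onePlusXPow 0 ⊛ q) j ≡ q j
⊛-unit q j = trans (⊛-coefficient (onePlusXPow 0) q j)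
  (trans (cong (1 * q j +_) (∑-zero (upTo j))) (trans (+-identityʳ _) (+-identityʳ _)))

⊛-pascal : ∀ (q : Poly) k j →
  (onePlusXPow (suc k) ⊛ q) (suc j) ≡ (onePlusXPow k ⊛ q) (suc j) + (onePlusXPow k ⊛ q) j
⊛-pascal q k j = begin
    (onePlusXPow (suc k) ⊛ q) (suc j)
  ≡⟨ ⊛-coefficient (onePlusXPow (suc k)) q (suc j) ⟩
    1 * q (suc j) + (∑[ i ← upTo (suc j) ] ((suc k C suc i) * q (j ∸ i)))
  ≡⟨ cong (1 * q (suc j) +_) (trans (∑-cong (upTo (suc j)) split) (∑-+ (upTo (suc j)) A₀ A₁)) ⟩
    1 * q (suc j) + (∑ (upTo (suc j)) A₀ + ∑ (upTo (suc j)) A₁)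
  ≡⟨ regroup (1 * q (suc j)) (∑ (upTo (suc j)) A₀) (∑ (upTo (suc j)) A₁) ⟩
    (1 * q (suc j) + ∑ (upTo (suc j)) A₁) + ∑ (upTo (suc j)) A₀
  ≡⟨ ≡-sym (cong₂ _+_ (⊛-coefficient (onePlusXPow k) q (suc j)) (sum-map _ (upTo (suc j)))) ⟩
    (onePlusXPow k ⊛ q) (suc j) + (onePlusXPow k ⊛ q) j
  ∎
  where
  open ≡-Reasoning
  A₀ A₁ : ℕ → ℕ
  A₀ i = (k C i) * q (j ∸ i)
  A₁ i = (k C suc i) * q (j ∸ i)
  split : ∀ i → (suc k C suc i) * q (j ∸ i) ≡ A₀ i + A₁ i
  split i = trans (cong (_* q (j ∸ i)) (≡-sym (nCk+nC[k+1]≡[n+1]C[k+1] k i)))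
                  (*-distribʳ-+ (q (j ∸ i)) (k C i) (k C suc i))
  regroup : ∀ a b c → a + (b + c) ≡ (a + c) + b
  regroup = solve-∀

⊛-combination : ∀ (xs : List A) (w F s : A → ℕ) k j →
  (onePlusXPow k ⊛ combination xs w F s) j ≡ combination xs w (λ x → F x + k) s j
⊛-combination xs w F s zero j = trans (⊛-unit (combination xs w F s) j)
  (∑-cong xs λ x → cong (λ e → w x * shiftedBinomial e (s x) j) (≡-sym (+-identityʳ (F x))))
⊛-combination xs w F s (suc k) zero = trans (⊛-combination xs w F s k zero)
  (∑-cong xs λ x → cong (w x *_) (≡-sym (step x)))
  where
  step : ∀ x → shiftedBinomial (F x + suc k) (s x) 0 ≡ shiftedBinomial (F x + k) (s x) 0
  step x = trans (cong (λ e → shiftedBinomial e (s x) 0) (+-suc (F x) k))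
                 (trans (shiftedBinomial-pascal (F x + k) (s x) 0) (+-identityʳ _))
⊛-combination xs w F s (suc k) (suc j) = begin
    (onePlusXPow (suc k) ⊛ combination xs w F s) (suc j)
  ≡⟨ ⊛-pascal (combination xs w F s) k j ⟩
    (onePlusXPow k ⊛ combination xs w F s) (suc j) + (onePlusXPow k ⊛ combination xs w F s) j
  ≡⟨ cong₂ _+_ (⊛-combination xs w F s k (suc j)) (⊛-combination xs w F s k j) ⟩
    combination xs w (λ x → F x + k) s (suc j) + combination xs w (λ x → F x + k) s j
  ≡⟨ ≡-sym (∑-+ xs _ _) ⟩
    ∑[ x ← xs ] (w x * shiftedBinomial (F x + k) (s x) (suc j) + w x * shiftedBinomial (F x + k) (s x) j)
  ≡⟨ ∑-cong xs (λ x → trans (≡-sym (*-distribˡ-+ (w x) _ _)) (cong (w x *_) (≡-sym (step x)))) ⟩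
    combination xs w (λ x → F x + suc k) s (suc j)
  ∎
  where
  open ≡-Reasoning
  step : ∀ x → shiftedBinomial (F x + suc k) (s x) (suc j)
             ≡ shiftedBinomial (F x + k) (s x) (suc j) + shiftedBinomial (F x + k) (s x) j
  step x = trans (cong (λ e → shiftedBinomial e (s x) (suc j)) (+-suc (F x) k))
                 (shiftedBinomial-pascal (F x + k) (s x) (suc j))

⊛-congʳ : ∀ (p : Poly) {q q′ : Poly} → (∀ j → q j ≡ q′ j) → ∀ j → (p ⊛ q) j ≡ (p ⊛ q′) j
⊛-congʳ p q≗q′ j = cong sum (map-cong (λ i → cong (p i *_) (q≗q′ (j ∸ i))) (upTo (suc j)))

⊛-factor : ∀ (xs : List A) (p : A → Bool) (F F′ s : A → ℕ) k → (∀ x → p x ≡ true → F x ≡ F′ x + k) →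
  ∀ j → combination xs (𝟙 ∘ p) F s j ≡ (onePlusXPow k ⊛ combination xs (𝟙 ∘ p) F′ s) j
⊛-factor xs p F F′ s k F≡F′+k j =
  trans (∑-𝟙-cong xs p (λ x px → cong (λ e → shiftedBinomial e (s x) j) (F≡F′+k x px)))
        (≡-sym (⊛-combination xs (𝟙 ∘ p) F′ s k j))

∧-split : ∀ x y → x ∧ y ≡ true → x ≡ true × y ≡ true
∧-split x y x∧y = ∧-conicalˡ x y x∧y , ∧-conicalʳ x y x∧y

bool-ext : ∀ {x y} → (x ≡ true → y ≡ true) → (y ≡ true → x ≡ true) → x ≡ y
bool-ext {true}  {true}  _ _ = refl
bool-ext {true}  {false} f _ = ≡-sym (f refl)
bool-ext {false} {true}  _ g = g refl
bool-ext {false} {false} _ _ = refl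

∧-exchange : ∀ x y z → x ∧ (y ∧ z) ≡ y ∧ (x ∧ z)
∧-exchange true  y z = refl
∧-exchange false y z = ≡-sym (∧-zeroʳ y)

and-++ : ∀ xs ys → and (xs ++ ys) ≡ and xs ∧ and ys
and-++ []       ys = refl
and-++ (x ∷ xs) ys = trans (cong (x ∧_) (and-++ xs ys)) (≡-sym (∧-assoc x (and xs) (and ys)))

and-++⇒ : ∀ xs ys → and (xs ++ ys) ≡ true → and xs ≡ true × and ys ≡ true
and-++⇒ xs ys all-xs++ys = ∧-split (and xs) (and ys) (trans (≡-sym (and-++ xs ys)) all-xs++ys)

and-map⇒ : ∀ (p : A → Bool) xs → and (map p xs) ≡ true → ∀ {x} → x ∈ xs → p x ≡ true
and-map⇒ p (y ∷ xs) all-p (here refl) = proj₁ (∧-split (p y) _ all-p)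
and-map⇒ p (y ∷ xs) all-p (there x∈xs) = and-map⇒ p xs (proj₂ (∧-split (p y) _ all-p)) x∈xs

and-map⇐ : ∀ (p : A → Bool) xs → (∀ x → x ∈ xs → p x ≡ true) → and (map p xs) ≡ true
and-map⇐ p []       all-p = refl
and-map⇐ p (y ∷ xs) all-p = cong₂ _∧_ (all-p y (here refl)) (and-map⇐ p xs (λ x → all-p x ∘ there))

and-pairs⇒ : ∀ (q : A → A → Bool) us vs → and (concatMap (λ u → map (q u) vs) us) ≡ true →
  ∀ {u v} → u ∈ us → v ∈ vs → q u v ≡ true
and-pairs⇒ q (w ∷ us) vs all-q (here refl)  v∈vs =
  and-map⇒ (q w) vs (proj₁ (and-++⇒ (map (q w) vs) (concatMap (λ u → map (q u) vs) us) all-q)) v∈vs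
and-pairs⇒ q (w ∷ us) vs all-q (there u∈us) v∈vs =
  and-pairs⇒ q us vs (proj₂ (and-++⇒ (map (q w) vs) (concatMap (λ u → map (q u) vs) us) all-q)) u∈us v∈vs

and-pairs⇐ : ∀ (q : A → A → Bool) us vs → (∀ u v → u ∈ us → v ∈ vs → q u v ≡ true) →
  and (concatMap (λ u → map (q u) vs) us) ≡ true
and-pairs⇐ q []       vs all-q = refl
and-pairs⇐ q (w ∷ us) vs all-q = trans (and-++ (map (q w) vs) (concatMap (λ u → map (q u) vs) us))
  (cong₂ _∧_ (and-map⇐ (q w) vs (λ v → all-q w v (here refl)))
             (and-pairs⇐ q us vs (λ u v u∈us → all-q u v (there u∈us))))

or-map⇒ : ∀ (p : A → Bool) xs → or (map p xs) ≡ true → ∃ λ x → p x ≡ true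
or-map⇒ p (y ∷ xs) some-p with p y in py
... | true  = y , py
... | false = or-map⇒ p xs some-p

or-map⇐ : ∀ (p : A → Bool) xs {x} → x ∈ xs → p x ≡ true → or (map p xs) ≡ true
or-map⇐ p (y ∷ xs) (here refl)  px = cong (_∨ or (map p xs)) px
or-map⇐ p (y ∷ xs) (there x∈xs) px = trans (cong (p y ∨_) (or-map⇐ p xs x∈xs px)) (∨-zeroʳ (p y))

or-map-∨ : ∀ (p q : A → Bool) xs → or (map (λ x → p x ∨ q x) xs) ≡ or (map p xs) ∨ or (map q xs)
or-map-∨ p q []       = refl
or-map-∨ p q (x ∷ xs) with p x | q x
... | true  | _     = refl
... | false | true  = ≡-sym (∨-zeroʳ (or (map p xs)))
... | false | false = or-map-∨ p q xs

∑-tabulate : ∀ {m} (g : Fin m → A) (f : A → ℕ) → ∑ (tabulate g) f ≡ ∑ (allFin m) (f ∘ g)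
∑-tabulate {m = m} g f =
  trans (cong (λ xs → ∑ xs f) (≡-sym (map-tabulate id g))) (∑-map g (allFin m) f)

∑-allFin-suc : ∀ m (f : Fin (suc m) → ℕ) → ∑ (allFin (suc m)) f ≡ f zero + ∑[ u ← allFin m ] f (suc u)
∑-allFin-suc m f = cong (f zero +_) (∑-tabulate {m = m} suc f)

∑-allFin-+ : ∀ m k (f : Fin (m + k) → ℕ) →
  ∑ (allFin (m + k)) f ≡ ∑[ u ← allFin m ] f (u ↑ˡ k) + ∑[ e ← allFin k ] f (m ↑ʳ e)
∑-allFin-+ zero    k f = refl
∑-allFin-+ (suc m) k f = begin
    ∑ (allFin (suc m + k)) f
  ≡⟨ trans (∑-allFin-suc (m + k) f) (cong (f zero +_) (∑-allFin-+ m k (f ∘ suc))) ⟩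
    f zero + (∑[ u ← allFin m ] f (suc (u ↑ˡ k)) + ∑[ e ← allFin k ] f (suc m ↑ʳ e))
  ≡⟨ ≡-sym (+-assoc (f zero) _ _) ⟩
    (f zero + ∑[ u ← allFin m ] f (suc (u ↑ˡ k))) + ∑[ e ← allFin k ] f (suc m ↑ʳ e)
  ≡⟨ cong (_+ ∑[ e ← allFin k ] f (suc m ↑ʳ e))
          (≡-sym (∑-allFin-suc m (λ u → f (u ↑ˡ k)))) ⟩
    ∑[ u ← allFin (suc m) ] f (u ↑ˡ k) + ∑[ e ← allFin k ] f (suc m ↑ʳ e)
  ∎
  where open ≡-Reasoning

∑-allFin-lookup : ∀ (xs : List A) (f : A → ℕ) → ∑[ e ← allFin (length xs) ] f (List.lookup xs e) ≡ ∑ xs f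
∑-allFin-lookup []       f = refl
∑-allFin-lookup (x ∷ xs) f =
  trans (∑-allFin-suc (length xs) (f ∘ List.lookup (x ∷ xs))) (cong (f x +_) (∑-allFin-lookup xs f))

∑-allFin-const : ∀ m c → ∑[ u ← allFin m ] c ≡ c * m
∑-allFin-const m c = begin
    ∑[ u ← allFin m ] c        ≡⟨ ∑-cong (allFin m) (λ _ → ≡-sym (*-identityʳ c)) ⟩
    ∑[ u ← allFin m ] (c * 1)  ≡⟨ ∑-*ˡ (allFin m) c (λ _ → 1) ⟩
    c * ∑[ u ← allFin m ] 1    ≡⟨ cong (c *_) (trans (∑-one (allFin m)) (length-tabulate id)) ⟩
    c * m                      ∎
  where open ≡-Reasoning

point : ∀ {m} → Fin m → Fin m → Bool
point v u = does (u ≟ᶠ v)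

point-refl : ∀ {m} (v : Fin m) → point v v ≡ true
point-refl v with v ≟ᶠ v
... | yes _   = refl
... | no  v≢v = ⊥-elim (v≢v refl)

point-sound : ∀ {m} {u v : Fin m} → point v u ≡ true → u ≡ v
point-sound {u = u} {v} u≐v with u ≟ᶠ v
point-sound u≐v | yes u≡v = u≡v

∑-point : ∀ m (v : Fin m) (h : Fin m → ℕ) → ∑[ u ← allFin m ] (𝟙 (point v u) * h u) ≡ h v
∑-point (suc m) zero    h = begin
    ∑[ u ← allFin (suc m) ] (𝟙 (point zero u) * h u)
  ≡⟨ ∑-allFin-suc m _ ⟩
    (h zero + 0) + ∑[ u ← allFin m ] 0
  ≡⟨ cong₂ _+_ (+-identityʳ (h zero)) (∑-zero (allFin m)) ⟩
    h zero + 0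
  ≡⟨ +-identityʳ (h zero) ⟩
    h zero
  ∎
  where open ≡-Reasoning
∑-point (suc m) (suc v) h =
  trans (∑-allFin-suc m (λ u → 𝟙 (point (suc v) u) * h u)) (∑-point m v (h ∘ suc))

multiplicity : ∀ {m} → List (Fin m) → Fin m → ℕ
multiplicity us u = ∑[ w ← us ] 𝟙 (point w u)

∑-by-multiplicity : ∀ m (us : List (Fin m)) (h : Fin m → ℕ) →
  ∑ us h ≡ ∑[ u ← allFin m ] (multiplicity us u * h u)
∑-by-multiplicity m []       h = ≡-sym (∑-zero (allFin m))
∑-by-multiplicity m (w ∷ us) h = begin
    h w + ∑ us h
  ≡⟨ cong₂ _+_ (≡-sym (∑-point m w h)) (∑-by-multiplicity m us h) ⟩
    ∑[ u ← allFin m ] (𝟙 (point w u) * h u) + ∑[ u ← allFin m ] (multiplicity us u * h u)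
  ≡⟨ ≡-sym (∑-+ (allFin m) _ _) ⟩
    ∑[ u ← allFin m ] (𝟙 (point w u) * h u + multiplicity us u * h u)
  ≡⟨ ∑-cong (allFin m) (λ u → ≡-sym (*-distribʳ-+ (h u) (𝟙 (point w u)) (multiplicity us u))) ⟩
    ∑[ u ← allFin m ] (multiplicity (w ∷ us) u * h u)
  ∎
  where open ≡-Reasoning

multiplicity-absent : ∀ {m} (u : Fin m) us → All (λ w → ¬ u ≡ w) us → multiplicity us u ≡ 0
multiplicity-absent u []       []           = refl
multiplicity-absent u (w ∷ us) (u≢w ∷ u∉us) with u ≟ᶠ w
... | yes u≡w = ⊥-elim (u≢w u≡w)
... | no  _   = multiplicity-absent u us u∉us

multiplicity-unique : ∀ {m} (us : List (Fin m)) → Unique us → ∀ u → multiplicity us u ≤ 1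
multiplicity-unique []       []              u = z≤n
multiplicity-unique (w ∷ us) (w∉us ∷ us-uniq) u with u ≟ᶠ w
... | yes refl = ≤-reflexive (cong suc (multiplicity-absent u us w∉us))
... | no  _    = multiplicity-unique us us-uniq u

size-∷ : ∀ {m} x (S : Subset m) → ∣ x ∷ S ∣ ≡ 𝟙 x + ∣ S ∣
size-∷ true  S = refl
size-∷ false S = refl

size-++ : ∀ {m k} (S : Subset m) (T : Subset k) → ∣ S Vec.++ T ∣ ≡ ∣ S ∣ + ∣ T ∣
size-++ []          T = refl
size-++ (true ∷ S)  T = cong suc (size-++ S T)
size-++ (false ∷ S) T = size-++ S T

size-tabulate : ∀ {b} (p : Fin b → Bool) → ∣ Vec.tabulate p ∣ ≡ ∑[ e ← allFin b ] 𝟙 (p e)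
size-tabulate {zero}  p = refl
size-tabulate {suc b} p = begin
    ∣ Vec.tabulate p ∣                           ≡⟨ size-∷ (p zero) (Vec.tabulate (p ∘ suc)) ⟩
    𝟙 (p zero) + ∣ Vec.tabulate (p ∘ suc) ∣     ≡⟨ cong (𝟙 (p zero) +_) (size-tabulate (p ∘ suc)) ⟩
    𝟙 (p zero) + ∑[ e ← allFin b ] 𝟙 (p (suc e)) ≡⟨ ≡-sym (∑-allFin-suc b (𝟙 ∘ p)) ⟩
    ∑[ e ← allFin (suc b) ] 𝟙 (p e)              ∎
  where open ≡-Reasoning

size-as-∑ : ∀ {m} (S : Subset m) → ∣ S ∣ ≡ ∑[ u ← allFin m ] 𝟙 (lookup S u)
size-as-∑ S = trans (cong ∣_∣ (≡-sym (tabulate∘lookup S))) (size-tabulate (lookup S))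

⊆ᵇ-sound : ∀ {m} (T F : Subset m) → T ⊆ᵇ F ≡ true → ∀ e → lookup T e ≡ true → lookup F e ≡ true
⊆ᵇ-sound (true ∷ T) (true ∷ F) T⊆F zero    _  = refl
⊆ᵇ-sound (t ∷ T)    (f ∷ F)    T⊆F (suc e) Te = ⊆ᵇ-sound T F (proj₂ (∧-split (not t ∨ f) _ T⊆F)) e Te

⊆ᵇ-complete : ∀ {m} (T F : Subset m) → (∀ e → lookup T e ≡ true → lookup F e ≡ true) → T ⊆ᵇ F ≡ true
⊆ᵇ-complete []          []      T⊆F = refl
⊆ᵇ-complete (false ∷ T) (f ∷ F) T⊆F = ⊆ᵇ-complete T F (T⊆F ∘ suc)
⊆ᵇ-complete (true ∷ T)  (f ∷ F) T⊆F = cong₂ _∧_ (T⊆F zero refl) (⊆ᵇ-complete T F (T⊆F ∘ suc))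

⊆ᵇ-refl : ∀ {m} (F : Subset m) → F ⊆ᵇ F ≡ true
⊆ᵇ-refl []          = refl
⊆ᵇ-refl (true ∷ F)  = ⊆ᵇ-refl F
⊆ᵇ-refl (false ∷ F) = ⊆ᵇ-refl F

⊆ᵇ-size : ∀ {m} (T F : Subset m) → T ⊆ᵇ F ≡ true → ∣ T ∣ ≤ ∣ F ∣
⊆ᵇ-size []          []          _   = z≤n
⊆ᵇ-size (true ∷ T)  (true ∷ F)  T⊆F = s≤s (⊆ᵇ-size T F T⊆F)
⊆ᵇ-size (false ∷ T) (true ∷ F)  T⊆F = m≤n⇒m≤1+n (⊆ᵇ-size T F T⊆F)
⊆ᵇ-size (false ∷ T) (false ∷ F) T⊆F = ⊆ᵇ-size T F T⊆F

meets : ∀ {m} → Subset m → (Fin m → Bool) → Bool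
meets {m} S N = or (map (λ u → lookup S u ∧ N u) (allFin m))

meets⇒ : ∀ {m} (S : Subset m) N → meets S N ≡ true → ∃ λ u → lookup S u ≡ true × N u ≡ true
meets⇒ {m} S N S∩N with or-map⇒ (λ u → lookup S u ∧ N u) (allFin m) S∩N
... | u , Su∧Nu = u , ∧-split (lookup S u) (N u) Su∧Nu

meets⇐ : ∀ {m} (S : Subset m) N u → lookup S u ≡ true → N u ≡ true → meets S N ≡ true
meets⇐ {m} S N u Su Nu = or-map⇐ (λ u → lookup S u ∧ N u) (allFin m) (∈-allFin u) (cong₂ _∧_ Su Nu)

meets-cong : ∀ {m} (S : Subset m) {N N′ : Fin m → Bool} → (∀ u → N u ≡ N′ u) → meets S N ≡ meets S N′
meets-cong {m} S N≗N′ = cong or (map-cong (λ u → cong (lookup S u ∧_) (N≗N′ u)) (allFin m))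

meets-∪ : ∀ {m} (S : Subset m) (N N′ : Fin m → Bool) →
  meets S (λ u → N u ∨ N′ u) ≡ meets S N ∨ meets S N′
meets-∪ {m} S N N′ =
  trans (cong or (map-cong (λ u → ∧-distribˡ-∨ (lookup S u) (N u) (N′ u)) (allFin m)))
        (or-map-∨ (λ u → lookup S u ∧ N u) (λ u → lookup S u ∧ N′ u) (allFin m))

meets-point : ∀ {m} (S : Subset m) v → meets S (point v) ≡ lookup S v
meets-point S v = bool-ext
  (λ S∋v′ → let (u , Su , u≐v) = meets⇒ S (point v) S∋v′
            in subst (λ w → lookup S w ≡ true) (point-sound u≐v) Su)
  (λ Sv → meets⇐ S (point v) v Sv (point-refl v))

∈-subsets : ∀ m (S : Subset m) → S ∈ subsets m
∈-subsets zero    []          = here refl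
∈-subsets (suc m) (false ∷ S) = ∈-++⁺ˡ (∈-map⁺ (false ∷_) (∈-subsets m S))
∈-subsets (suc m) (true ∷ S)  = ∈-++⁺ʳ (map (false ∷_) (subsets m)) (∈-map⁺ (true ∷_) (∈-subsets m S))

foldr-⊔-attained : ∀ (f : A → ℕ) N (xs : List A) → (∀ x → x ∈ xs → f x ≤ N) →
  ∀ {x₀} → x₀ ∈ xs → f x₀ ≡ N → foldr (λ x acc → f x ⊔ acc) 0 xs ≡ N
foldr-⊔-attained f N xs bounded {x₀} x₀∈xs fx₀≡N =
  ≤-antisym (upper xs bounded) (subst (_≤ foldr (λ x acc → f x ⊔ acc) 0 xs) fx₀≡N (lower xs x₀∈xs))
  where
  upper : ∀ xs → (∀ x → x ∈ xs → f x ≤ N) → foldr (λ x acc → f x ⊔ acc) 0 xs ≤ N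
  upper []       _       = z≤n
  upper (y ∷ xs) bounded = ⊔-lub (bounded y (here refl)) (upper xs (λ x → bounded x ∘ there))
  lower : ∀ xs → x₀ ∈ xs → f x₀ ≤ foldr (λ x acc → f x ⊔ acc) 0 xs
  lower (y ∷ xs) (here refl)  = m≤m⊔n (f y) _
  lower (y ∷ xs) (there x₀∈xs) = ≤-trans (lower xs x₀∈xs) (m≤n⊔m (f y) _)

data Side (m b : ℕ) : Fin (m + b) → Set where
  left  : ∀ u → Side m b (u ↑ˡ b)
  right : ∀ e → Side m b (m ↑ʳ e)

side : ∀ m b (x : Fin (m + b)) → Side m b x
side m b x = subst (Side m b) (join-splitAt m b x) (fromSum (splitAt m x))
  where
  fromSum : (y : Fin m ⊎ Fin b) → Side m b (join m b y)
  fromSum (inj₁ u) = left u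
  fromSum (inj₂ e) = right e

clash : ∀ {m} → (Fin m → Fin m → Bool) → Subset m → Fin m → Fin m → Bool
clash R S x y = lookup S x ∧ lookup S y ∧ R x y

clash-sym : ∀ {m} {R : Fin m → Fin m → Bool} → (∀ x y → R x y ≡ R y x) →
  ∀ S x y → clash R S x y ≡ clash R S y x
clash-sym {R = R} R-sym S x y =
  trans (∧-exchange (lookup S x) (lookup S y) (R x y)) (cong (λ r → lookup S y ∧ lookup S x ∧ r) (R-sym x y))

independentᵇ : ∀ {m} → (Fin m → Fin m → Bool) → Subset m → Bool
independentᵇ {m} R S = and (concatMap (λ u → map (λ v → not (clash R S u v)) (allFin m)) (allFin m))

Independent : ∀ {m} → (Fin m → Fin m → Bool) → Subset m → Set
Independent R S = ∀ u v → clash R S u v ≡ false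

independentᵇ-sound : ∀ {m} (R : Fin m → Fin m → Bool) S → independentᵇ R S ≡ true → Independent R S
independentᵇ-sound {m} R S indep u v =
  not-injective (and-pairs⇒ (λ u v → not (clash R S u v)) (allFin m) (allFin m) indep (∈-allFin u) (∈-allFin v))

independentᵇ-complete : ∀ {m} (R : Fin m → Fin m → Bool) S → Independent R S → independentᵇ R S ≡ true
independentᵇ-complete {m} R S indep =
  and-pairs⇐ (λ u v → not (clash R S u v)) (allFin m) (allFin m) (λ u v _ _ → cong not (indep u v))

-- The adjacency A of the extended graph on
-- Fin (n G + b) is given abstractly through its values on the two blocks, so
-- that both the corona and the padded graph below are instances.
module Extension (G : Graph) {b : ℕ} (N : Fin b → Fin (n G) → Bool)
  (A : Fin (n G + b) → Fin (n G + b) → Bool)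
  (A-sym : ∀ x y → A x y ≡ A y x) (A-irrefl : ∀ x → A x x ≡ false)
  (old-old : ∀ u v → A (u ↑ˡ b) (v ↑ˡ b) ≡ adj G u v)
  (old-new : ∀ u e → A (u ↑ˡ b) (n G ↑ʳ e) ≡ N e u)
  (new-new : ∀ e e′ → A (n G ↑ʳ e) (n G ↑ʳ e′) ≡ false) where

  extended : Graph
  extended = record { n = n G + b ; adj = A ; sym = A-sym ; irrefl = A-irrefl }

  G⊆extended : G ⊆G extended
  G⊆extended = (_↑ˡ b) , (λ {u} {v} → ↑ˡ-injective b u v) , λ u v uv → trans (old-old u v) uv

  free : Subset (n G) → Subset b
  free S = Vec.tabulate (λ e → not (meets S (N e)))

  lookup-free : ∀ S e → lookup (free S) e ≡ not (meets S (N e))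
  lookup-free S e = lookup∘tabulate (λ e → not (meets S (N e))) e

  module _ (S : Subset (n G)) (T : Subset b) where
    private
      U = S Vec.++ T

    clash-old-old : ∀ u v → clash A U (u ↑ˡ b) (v ↑ˡ b) ≡ clash (adj G) S u v
    clash-old-old u v =
      trans (cong₂ (λ x y → x ∧ y ∧ A (u ↑ˡ b) (v ↑ˡ b)) (lookup-++ˡ S T u) (lookup-++ˡ S T v))
            (cong (λ a → lookup S u ∧ lookup S v ∧ a) (old-old u v))

    clash-old-new : ∀ u e → clash A U (u ↑ˡ b) (n G ↑ʳ e) ≡ (lookup S u ∧ lookup T e ∧ N e u)
    clash-old-new u e =
      trans (cong₂ (λ x y → x ∧ y ∧ A (u ↑ˡ b) (n G ↑ʳ e)) (lookup-++ˡ S T u) (lookup-++ʳ S T e))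
            (cong (λ a → lookup S u ∧ lookup T e ∧ a) (old-new u e))

    clash-new-old : ∀ e u → clash A U (n G ↑ʳ e) (u ↑ˡ b) ≡ (lookup S u ∧ lookup T e ∧ N e u)
    clash-new-old e u = trans (clash-sym A-sym U (n G ↑ʳ e) (u ↑ˡ b)) (clash-old-new u e)

    clash-new-new : ∀ e e′ → clash A U (n G ↑ʳ e) (n G ↑ʳ e′) ≡ false
    clash-new-new e e′ = begin
        lookup U (n G ↑ʳ e) ∧ lookup U (n G ↑ʳ e′) ∧ A (n G ↑ʳ e) (n G ↑ʳ e′)
      ≡⟨ cong (λ a → lookup U (n G ↑ʳ e) ∧ lookup U (n G ↑ʳ e′) ∧ a) (new-new e e′) ⟩
        lookup U (n G ↑ʳ e) ∧ lookup U (n G ↑ʳ e′) ∧ false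
      ≡⟨ cong (lookup U (n G ↑ʳ e) ∧_) (∧-zeroʳ (lookup U (n G ↑ʳ e′))) ⟩
        lookup U (n G ↑ʳ e) ∧ false
      ≡⟨ ∧-zeroʳ (lookup U (n G ↑ʳ e)) ⟩
        false
      ∎
      where open ≡-Reasoning

  decomposition⇒ : ∀ S T → independentᵇ A (S Vec.++ T) ≡ true →
    isIndependent G S ≡ true × T ⊆ᵇ free S ≡ true
  decomposition⇒ S T indep = independentᵇ-complete (adj G) S S-indep , ⊆ᵇ-complete T (free S) T-free
    where
    no-clash : Independent A (S Vec.++ T)
    no-clash = independentᵇ-sound A (S Vec.++ T) indep
    S-indep : Independent (adj G) S
    S-indep u v = trans (≡-sym (clash-old-old S T u v)) (no-clash (u ↑ˡ b) (v ↑ˡ b))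
    S-misses : ∀ e → lookup T e ≡ true → meets S (N e) ≡ true → ⊥
    S-misses e Te S∩Ne with meets⇒ S (N e) S∩Ne
    ... | u , Su , Neu = case false≡true of λ ()
      where
      edge : (lookup S u ∧ lookup T e ∧ N e u) ≡ true
      edge = trans (cong₂ (λ x y → x ∧ y ∧ N e u) Su Te) Neu
      false≡true : false ≡ true
      false≡true = trans (≡-sym (no-clash (u ↑ˡ b) (n G ↑ʳ e))) (trans (clash-old-new S T u e) edge)
    T-free : ∀ e → lookup T e ≡ true → lookup (free S) e ≡ true
    T-free e Te = trans (lookup-free S e) (cong not (¬-not (S-misses e Te)))

  decomposition⇐ : ∀ S T → isIndependent G S ≡ true → T ⊆ᵇ free S ≡ true →
    independentᵇ A (S Vec.++ T) ≡ true
  decomposition⇐ S T S-indep T-free = independentᵇ-complete A (S Vec.++ T) no-clash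
    where
    no-edge-to-S : ∀ u e → (lookup S u ∧ lookup T e ∧ N e u) ≡ false
    no-edge-to-S u e = ¬-not λ edge →
      let (Su , Te∧Neu) = ∧-split (lookup S u) _ edge
          (Te , Neu)    = ∧-split (lookup T e) (N e u) Te∧Neu
          S-misses      = not-injective (trans (≡-sym (lookup-free S e)) (⊆ᵇ-sound T (free S) T-free e Te))
      in case trans (≡-sym (meets⇐ S (N e) u Su Neu)) S-misses of λ ()
    no-clash : Independent A (S Vec.++ T)
    no-clash x y with side (n G) b x | side (n G) b y
    ... | left u  | left v   = trans (clash-old-old S T u v) (independentᵇ-sound (adj G) S S-indep u v)
    ... | left u  | right e  = trans (clash-old-new S T u e) (no-edge-to-S u e)
    ... | right e | left u   = trans (clash-new-old S T e u) (no-edge-to-S u e)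
    ... | right e | right e′ = clash-new-new S T e e′

  decomposition : ∀ S T → independentᵇ A (S Vec.++ T) ≡ isIndependent G S ∧ T ⊆ᵇ free S
  decomposition S T = bool-ext
    (λ indep → let (S-indep , T-free) = decomposition⇒ S T indep in cong₂ _∧_ S-indep T-free)
    (λ both → let (S-indep , T-free) = ∧-split _ _ both in decomposition⇐ S T S-indep T-free)

  indCoeff-extended : ∀ j →
    indCoeff extended j ≡ combination (subsets (n G)) (𝟙 ∘ isIndependent G) (∣_∣ ∘ free) ∣_∣ j
  indCoeff-extended j = begin
      indCoeff extended j
    ≡⟨ length-filter-filter (λ U → ∣ U ∣ ≟ j) (λ U → independentᵇ A U Bool.≟ true) (subsets (n G + b)) ⟩
      ∑[ U ← subsets (n G + b) ] 𝟙 (does (independentᵇ A U Bool.≟ true) ∧ does (∣ U ∣ ≟ j))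
    ≡⟨ ∑-cong (subsets (n G + b)) (λ U →
         cong (λ t → 𝟙 (t ∧ does (∣ U ∣ ≟ j))) (does-≟-true (independentᵇ A U))) ⟩
      ∑[ U ← subsets (n G + b) ] 𝟙 (independentᵇ A U ∧ does (∣ U ∣ ≟ j))
    ≡⟨ ∑-subsets-++ (n G) b _ ⟩
      ∑[ S ← subsets (n G) ] ∑[ T ← subsets b ]
        𝟙 (independentᵇ A (S Vec.++ T) ∧ does (∣ S Vec.++ T ∣ ≟ j))
    ≡⟨ ∑-cong (subsets (n G)) (λ S → ∑-cong (subsets b) (λ T →
         cong₂ (λ t i → 𝟙 (t ∧ does (i ≟ j))) (decomposition S T) (size-++ S T))) ⟩
      ∑[ S ← subsets (n G) ] ∑[ T ← subsets b ]
        𝟙 ((isIndependent G S ∧ T ⊆ᵇ free S) ∧ does (∣ S ∣ + ∣ T ∣ ≟ j))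
    ≡⟨ ∑-cong (subsets (n G)) (λ S → count-free S (isIndependent G S)) ⟩
      combination (subsets (n G)) (𝟙 ∘ isIndependent G) (∣_∣ ∘ free) ∣_∣ j
    ∎
    where
    open ≡-Reasoning
    does-≟-true : ∀ t → does (t Bool.≟ true) ≡ t
    does-≟-true true  = refl
    does-≟-true false = refl
    count-free : ∀ S t →
      ∑[ T ← subsets b ] 𝟙 ((t ∧ T ⊆ᵇ free S) ∧ does (∣ S ∣ + ∣ T ∣ ≟ j))
        ≡ 𝟙 t * shiftedBinomial (∣ free S ∣) (∣ S ∣) j
    count-free S true  = trans (count-subsets-of b (free S) (∣ S ∣) j) (≡-sym (+-identityʳ _))
    count-free S false = ∑-zero (subsets b)

  free-size : ∀ S → ∣ free S ∣ + ∑[ e ← allFin b ] 𝟙 (meets S (N e)) ≡ b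
  free-size S = begin
      ∣ free S ∣ + ∑[ e ← allFin b ] 𝟙 (meets S (N e))
    ≡⟨ cong (_+ ∑[ e ← allFin b ] 𝟙 (meets S (N e))) (size-tabulate (λ e → not (meets S (N e)))) ⟩
      ∑[ e ← allFin b ] 𝟙 (not (meets S (N e))) + ∑[ e ← allFin b ] 𝟙 (meets S (N e))
    ≡⟨ ≡-sym (∑-+ (allFin b) _ _) ⟩
      ∑[ e ← allFin b ] (𝟙 (not (meets S (N e))) + 𝟙 (meets S (N e)))
    ≡⟨ ∑-cong (allFin b) (λ e → complement (meets S (N e))) ⟩
      ∑[ e ← allFin b ] 1
    ≡⟨ trans (∑-allFin-const b 1) (*-identityˡ b) ⟩
      b
    ∎
    where
    open ≡-Reasoning
    complement : ∀ t → 𝟙 (not t) + 𝟙 t ≡ 1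
    complement true  = refl
    complement false = refl

  Balanced : Set
  Balanced = ∀ S → isIndependent G S ≡ true → ∑[ e ← allFin b ] 𝟙 (meets S (N e)) ≡ ∣ S ∣ + ∣ S ∣

  module _ (balanced : Balanced) where

    free-balance : ∀ S → isIndependent G S ≡ true → ∣ free S ∣ + ∣ S ∣ + ∣ S ∣ ≡ b
    free-balance S S-indep =
      trans (+-assoc (∣ free S ∣) (∣ S ∣) (∣ S ∣))
            (trans (cong (∣ free S ∣ +_) (≡-sym (balanced S S-indep))) (free-size S))

    size-bound : ∀ U → U ∈ independentSets extended → ∣ U ∣ ≤ b
    size-bound U U-indep with Vec.splitAt (n G) U
    ... | S , T , refl = begin
        ∣ S Vec.++ T ∣                 ≡⟨ size-++ S T ⟩
        ∣ S ∣ + ∣ T ∣                  ≤⟨ +-monoʳ-≤ (∣ S ∣) (⊆ᵇ-size T (free S) T-free) ⟩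
        ∣ S ∣ + ∣ free S ∣             ≤⟨ m≤n+m (∣ S ∣ + ∣ free S ∣) (∣ S ∣) ⟩
        ∣ S ∣ + (∣ S ∣ + ∣ free S ∣)   ≡⟨ rearrange (∣ S ∣) (∣ free S ∣) ⟩
        ∣ free S ∣ + ∣ S ∣ + ∣ S ∣     ≡⟨ free-balance S S-indep ⟩
        b                              ∎
      where
      open ≤-Reasoning
      parts = decomposition⇒ S T
        (proj₂ (∈-filter⁻ (λ U → isIndependent extended U Bool.≟ true) {xs = subsets (n G + b)} U-indep))
      S-indep = proj₁ parts
      T-free  = proj₂ parts
      rearrange : ∀ s f → s + (s + f) ≡ f + s + s
      rearrange = solve-∀

    ∅ᴳ : Subset (n G)
    ∅ᴳ = ∅

    all-new : Subset (n G + b)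
    all-new = ∅ᴳ Vec.++ free ∅ᴳ

    ∅ᴳ-independent : isIndependent G ∅ᴳ ≡ true
    ∅ᴳ-independent = independentᵇ-complete (adj G) ∅ᴳ
      (λ u v → cong (λ x → x ∧ lookup ∅ᴳ v ∧ adj G u v) (lookup-replicate u false))

    all-new-independent : all-new ∈ independentSets extended
    all-new-independent = ∈-filter⁺ (λ U → isIndependent extended U Bool.≟ true) (∈-subsets (n G + b) all-new)
      (decomposition⇐ ∅ᴳ (free ∅ᴳ) ∅ᴳ-independent (⊆ᵇ-refl (free ∅ᴳ)))

    size-all-new : ∣ all-new ∣ ≡ b
    size-all-new = begin
      ∣ ∅ᴳ Vec.++ free ∅ᴳ ∣           ≡⟨ size-++ ∅ᴳ (free ∅ᴳ) ⟩
      ∣ ∅ᴳ ∣ + ∣ free ∅ᴳ ∣            ≡⟨ cong (_+ ∣ free ∅ᴳ ∣) ∣∅ᴳ∣≡0 ⟩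
      ∣ free ∅ᴳ ∣                    ≡⟨ ≡-sym (trans (+-identityʳ _) (+-identityʳ _)) ⟩
      ∣ free ∅ᴳ ∣ + 0 + 0            ≡⟨ cong (λ z → ∣ free ∅ᴳ ∣ + z + z) (≡-sym ∣∅ᴳ∣≡0) ⟩
      ∣ free ∅ᴳ ∣ + ∣ ∅ᴳ ∣ + ∣ ∅ᴳ ∣   ≡⟨ free-balance ∅ᴳ ∅ᴳ-independent ⟩
      b                             ∎
      where
      open ≡-Reasoning
      ∣∅ᴳ∣≡0 : ∣ ∅ᴳ ∣ ≡ 0
      ∣∅ᴳ∣≡0 = ∣⊥∣≡0 (n G)

    α-extended : indepNumber extended ≡ b
    α-extended = foldr-⊔-attained ∣_∣ b (independentSets extended) size-bound all-new-independent size-all-new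

    -- Each term x^|S| (1+x)^|free S| of (★) is palindromic of degree b.
    palindromic-extended : ∀ j → j ≤ b → indCoeff extended j ≡ indCoeff extended (b ∸ j)
    palindromic-extended j j≤b = begin
        indCoeff extended j
      ≡⟨ indCoeff-extended j ⟩
        combination (subsets (n G)) (𝟙 ∘ isIndependent G) (∣_∣ ∘ free) ∣_∣ j
      ≡⟨ ∑-𝟙-cong (subsets (n G)) (isIndependent G) (λ S S-indep →
           shiftedBinomial-palindromic (∣ free S ∣) (∣ S ∣) j (b ∸ j)
             (trans (m+[n∸m]≡n j≤b) (≡-sym (free-balance S S-indep)))) ⟩
        combination (subsets (n G)) (𝟙 ∘ isIndependent G) (∣_∣ ∘ free) ∣_∣ (b ∸ j)
      ≡⟨ ≡-sym (indCoeff-extended (b ∸ j)) ⟩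
        indCoeff extended (b ∸ j)
      ∎
      where open ≡-Reasoning

    symmetric-extended : Symmetric extended
    symmetric-extended j j≤⌊α/2⌋ rewrite α-extended =
      palindromic-extended j (≤-trans j≤⌊α/2⌋ (⌊n/2⌋≤n b))

module Attach (G : Graph) {b : ℕ} (N : Fin b → Fin (n G) → Bool) where

  blockAdj : Fin (n G) ⊎ Fin b → Fin (n G) ⊎ Fin b → Bool
  blockAdj (inj₁ u) (inj₁ v) = adj G u v
  blockAdj (inj₁ u) (inj₂ e) = N e u
  blockAdj (inj₂ e) (inj₁ u) = N e u
  blockAdj (inj₂ e) (inj₂ f) = false

  blockAdj-sym : ∀ x y → blockAdj x y ≡ blockAdj y x
  blockAdj-sym (inj₁ u) (inj₁ v) = Graph.sym G u v
  blockAdj-sym (inj₁ u) (inj₂ e) = refl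
  blockAdj-sym (inj₂ e) (inj₁ u) = refl
  blockAdj-sym (inj₂ e) (inj₂ f) = refl

  blockAdj-irrefl : ∀ x → blockAdj x x ≡ false
  blockAdj-irrefl (inj₁ u) = irrefl G u
  blockAdj-irrefl (inj₂ e) = refl

  attachAdj : Fin (n G + b) → Fin (n G + b) → Bool
  attachAdj x y = blockAdj (splitAt (n G) x) (splitAt (n G) y)

  open Extension G N attachAdj
    (λ x y → blockAdj-sym (splitAt (n G) x) (splitAt (n G) y))
    (λ x → blockAdj-irrefl (splitAt (n G) x))
    (λ u v → cong₂ blockAdj (splitAt-↑ˡ (n G) u b) (splitAt-↑ˡ (n G) v b))
    (λ u e → cong₂ blockAdj (splitAt-↑ˡ (n G) u b) (splitAt-↑ʳ (n G) b e))
    (λ e e′ → cong₂ blockAdj (splitAt-↑ʳ (n G) b e) (splitAt-↑ʳ (n G) b e′))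
    public

-- The corona G ∘ 2K₁ is the extension of G by 2n pendant vertices, the
-- neighbourhood of each being a single vertex; it is balanced.
module CoronaExtension (G : Graph) where
  private
    m = n G

  part-old : ∀ (u : Fin m) → part {m} (u ↑ˡ (m + m)) ≡ core u
  part-old u rewrite splitAt-↑ˡ m u (m + m) = refl

  part-leaf₁ : ∀ (v : Fin m) → part {m} (m ↑ʳ (v ↑ˡ m)) ≡ leaf₁ v
  part-leaf₁ v rewrite splitAt-↑ʳ m (m + m) (v ↑ˡ m) | splitAt-↑ˡ m v m = refl

  part-leaf₂ : ∀ (v : Fin m) → part {m} (m ↑ʳ (m ↑ʳ v)) ≡ leaf₂ v
  part-leaf₂ v rewrite splitAt-↑ʳ m (m + m) (m ↑ʳ v) | splitAt-↑ʳ m m v = refl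

  pendant : Fin (m + m) → Fin m → Bool
  pendant e u = coronaAdj′ G (core u) (part {m} (m ↑ʳ e))

  pendant-leaf₁ : ∀ v u → pendant (v ↑ˡ m) u ≡ point v u
  pendant-leaf₁ v u = trans (cong (coronaAdj′ G (core u)) (part-leaf₁ v)) (isYes≗does (u ≟ᶠ v))

  pendant-leaf₂ : ∀ v u → pendant (m ↑ʳ v) u ≡ point v u
  pendant-leaf₂ v u = trans (cong (coronaAdj′ G (core u)) (part-leaf₂ v)) (isYes≗does (u ≟ᶠ v))

  private
    G∘2K₁ = corona2K1 G

    old-old : ∀ u v → adj G∘2K₁ (u ↑ˡ (m + m)) (v ↑ˡ (m + m)) ≡ adj G u v
    old-old u v = cong₂ (coronaAdj′ G) (part-old u) (part-old v)

    old-new : ∀ u e → adj G∘2K₁ (u ↑ˡ (m + m)) (m ↑ʳ e) ≡ pendant e u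
    old-new u e = cong (λ x → coronaAdj′ G x (part {m} (m ↑ʳ e))) (part-old u)

    leaves-non-adjacent : ∀ e e′ → adj G∘2K₁ (m ↑ʳ e) (m ↑ʳ e′) ≡ false
    leaves-non-adjacent e e′ with side m m e | side m m e′
    ... | left v  | left v′  rewrite part-leaf₁ v | part-leaf₁ v′ = refl
    ... | left v  | right v′ rewrite part-leaf₁ v | part-leaf₂ v′ = refl
    ... | right v | left v′  rewrite part-leaf₂ v | part-leaf₁ v′ = refl
    ... | right v | right v′ rewrite part-leaf₂ v | part-leaf₂ v′ = refl

  open Extension G pendant (adj G∘2K₁) (Graph.sym G∘2K₁) (irrefl G∘2K₁)
    old-old old-new leaves-non-adjacent public

  -- Each vertex of S meets its two pendant vertices, and no others.
  balanced : Balanced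
  balanced S _ = begin
      ∑[ e ← allFin (m + m) ] 𝟙 (meets S (pendant e))
    ≡⟨ ∑-allFin-+ m m (λ e → 𝟙 (meets S (pendant e))) ⟩
      ∑[ v ← allFin m ] 𝟙 (meets S (pendant (v ↑ˡ m)))
        + ∑[ v ← allFin m ] 𝟙 (meets S (pendant (m ↑ʳ v)))
    ≡⟨ cong₂ _+_ (∑-cong (allFin m) (λ v → cong 𝟙 (meets-leaf₁ v)))
                 (∑-cong (allFin m) (λ v → cong 𝟙 (meets-leaf₂ v))) ⟩
      ∑[ v ← allFin m ] 𝟙 (lookup S v) + ∑[ v ← allFin m ] 𝟙 (lookup S v)
    ≡⟨ ≡-sym (cong₂ _+_ (size-as-∑ S) (size-as-∑ S)) ⟩
      ∣ S ∣ + ∣ S ∣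
    ∎
    where
    open ≡-Reasoning
    meets-leaf₁ : ∀ v → meets S (pendant (v ↑ˡ m)) ≡ lookup S v
    meets-leaf₁ v = trans (meets-cong S (pendant-leaf₁ v)) (meets-point S v)
    meets-leaf₂ : ∀ v → meets S (pendant (m ↑ʳ v)) ≡ lookup S v
    meets-leaf₂ v = trans (meets-cong S (pendant-leaf₂ v)) (meets-point S v)

endpoints : ∀ {m} → List (Fin m × Fin m) → List (Fin m)
endpoints L = concatMap (λ e → proj₁ e ∷ proj₂ e ∷ []) L

-- The graph H built from G and a matching L: one new vertex adjacent to both
-- ends of each edge of L, and 2 − (number of edges of L at u) pendant vertices
-- at each vertex u.  Every vertex then has exactly two new neighbours.
module Padding (G : Graph) (L : List (Fin (n G) × Fin (n G))) (L-matching : IsMatching G L) where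
  private
    m = n G

  covered : Fin m → ℕ
  covered = multiplicity (endpoints L)

  covered≤2 : ∀ u → covered u ≤ 2
  covered≤2 u = ≤-trans (multiplicity-unique (endpoints L) (proj₂ L-matching) u) (s≤s z≤n)

  edgeNeighbourhood : Fin m × Fin m → Fin m → Bool
  edgeNeighbourhood e u = point (proj₁ e) u ∨ point (proj₂ e) u

  newNeighbourhoods : List (Fin m → Bool)
  newNeighbourhoods =
    map edgeNeighbourhood L ++ concatMap (λ u → replicate (2 ∸ covered u) (point u)) (allFin m)

  open Attach G (List.lookup newNeighbourhoods) public

  ∑-newNeighbourhoods : ∀ (f : (Fin m → Bool) → ℕ) →
    ∑ newNeighbourhoods f
      ≡ ∑ L (f ∘ edgeNeighbourhood) + ∑[ u ← allFin m ] ((2 ∸ covered u) * f (point u))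
  ∑-newNeighbourhoods f = begin
      ∑ newNeighbourhoods f
    ≡⟨ ∑-++ (map edgeNeighbourhood L) _ f ⟩
      ∑ (map edgeNeighbourhood L) f + ∑ (concatMap (λ u → replicate (2 ∸ covered u) (point u)) (allFin m)) f
    ≡⟨ cong₂ _+_ (∑-map edgeNeighbourhood L f)
                 (trans (∑-concatMap _ (allFin m) f)
                        (∑-cong (allFin m) (λ u → ∑-replicate (2 ∸ covered u) (point u) f))) ⟩
      ∑ L (f ∘ edgeNeighbourhood) + ∑[ u ← allFin m ] ((2 ∸ covered u) * f (point u))
    ∎
    where open ≡-Reasoning

  -- Counting every vertex once per edge of L at it and once per pendant vertex
  -- counts every vertex twice.
  ∑-endpoints-padded : ∀ (h : Fin m → ℕ) →
    ∑ (endpoints L) h + ∑[ u ← allFin m ] ((2 ∸ covered u) * h u) ≡ 2 * ∑ (allFin m) h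
  ∑-endpoints-padded h = begin
      ∑ (endpoints L) h + ∑[ u ← allFin m ] ((2 ∸ covered u) * h u)
    ≡⟨ cong (_+ ∑[ u ← allFin m ] ((2 ∸ covered u) * h u)) (∑-by-multiplicity m (endpoints L) h) ⟩
      ∑[ u ← allFin m ] (covered u * h u) + ∑[ u ← allFin m ] ((2 ∸ covered u) * h u)
    ≡⟨ ≡-sym (∑-+ (allFin m) _ _) ⟩
      ∑[ u ← allFin m ] (covered u * h u + (2 ∸ covered u) * h u)
    ≡⟨ ∑-cong (allFin m) (λ u → trans (≡-sym (*-distribʳ-+ (h u) (covered u) (2 ∸ covered u)))
                                       (cong (_* h u) (m+[n∸m]≡n (covered≤2 u)))) ⟩
      ∑[ u ← allFin m ] (2 * h u)
    ≡⟨ ∑-*ˡ (allFin m) 2 h ⟩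
      2 * ∑ (allFin m) h
    ∎
    where open ≡-Reasoning

  new-count : length newNeighbourhoods + length L ≡ m + m
  new-count = begin
      length newNeighbourhoods + length L
    ≡⟨ cong (_+ length L) (trans (≡-sym (∑-one newNeighbourhoods)) (∑-newNeighbourhoods (λ _ → 1))) ⟩
      ∑[ e ← L ] 1 + pendants + length L
    ≡⟨ cong (∑[ e ← L ] 1 + pendants +_) (≡-sym (∑-one L)) ⟩
      ∑[ e ← L ] 1 + pendants + ∑[ e ← L ] 1
    ≡⟨ rearrange (∑[ e ← L ] 1) pendants ⟩
      (∑[ e ← L ] 1 + ∑[ e ← L ] 1) + pendants
    ≡⟨ cong (_+ pendants) (≡-sym (trans (∑-concatMap _ L (λ _ → 1)) (∑-+ L (λ _ → 1) (λ _ → 1)))) ⟩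
      ∑[ u ← endpoints L ] 1 + pendants
    ≡⟨ ∑-endpoints-padded (λ _ → 1) ⟩
      2 * ∑[ u ← allFin m ] 1
    ≡⟨ cong (2 *_) (trans (∑-allFin-const m 1) (*-identityˡ m)) ⟩
      2 * m
    ≡⟨ cong (m +_) (+-identityʳ m) ⟩
      m + m
    ∎
    where
    open ≡-Reasoning
    pendants = ∑[ u ← allFin m ] ((2 ∸ covered u) * 1)
    rearrange : ∀ l p → l + p + l ≡ (l + l) + p
    rearrange = solve-∀

  -- An independent set meets the new vertex of an edge of G exactly when it
  -- contains one of its endpoints, and it never contains both.
  meets-edge : ∀ S → isIndependent G S ≡ true → ∀ e → adj G (proj₁ e) (proj₂ e) ≡ true →
    𝟙 (meets S (edgeNeighbourhood e)) ≡ ∑ (proj₁ e ∷ proj₂ e ∷ []) (𝟙 ∘ lookup S)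
  meets-edge S S-indep (a , b′) ab
    rewrite meets-∪ S (point a) (point b′) | meets-point S a | meets-point S b′
    with lookup S a in Sa | lookup S b′ in Sb
  ... | true  | true  = case trans (≡-sym (independentᵇ-sound (adj G) S S-indep a b′))
                                   (trans (cong₂ (λ x y → x ∧ y ∧ adj G a b′) Sa Sb) ab) of λ ()
  ... | true  | false = refl
  ... | false | true  = refl
  ... | false | false = refl

  balanced : Balanced
  balanced S S-indep = begin
      ∑[ e ← allFin (length newNeighbourhoods) ] 𝟙 (meets S (List.lookup newNeighbourhoods e))
    ≡⟨ ∑-allFin-lookup newNeighbourhoods (𝟙 ∘ meets S) ⟩
      ∑ newNeighbourhoods (𝟙 ∘ meets S)
    ≡⟨ ∑-newNeighbourhoods (𝟙 ∘ meets S) ⟩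
      ∑[ e ← L ] 𝟙 (meets S (edgeNeighbourhood e))
        + ∑[ u ← allFin m ] ((2 ∸ covered u) * 𝟙 (meets S (point u)))
    ≡⟨ cong₂ _+_ (trans (∑-cong-All L (proj₁ L-matching) (meets-edge S S-indep))
                        (≡-sym (∑-concatMap _ L (𝟙 ∘ lookup S))))
                 (∑-cong (allFin m) (λ u → cong (λ t → (2 ∸ covered u) * 𝟙 t) (meets-point S u))) ⟩
      ∑ (endpoints L) (𝟙 ∘ lookup S) + ∑[ u ← allFin m ] ((2 ∸ covered u) * 𝟙 (lookup S u))
    ≡⟨ ∑-endpoints-padded (𝟙 ∘ lookup S) ⟩
      2 * ∑[ u ← allFin m ] 𝟙 (lookup S u)
    ≡⟨ cong (2 *_) (≡-sym (size-as-∑ S)) ⟩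
      2 * ∣ S ∣
    ≡⟨ cong (∣ S ∣ +_) (+-identityʳ (∣ S ∣)) ⟩
      ∣ S ∣ + ∣ S ∣
    ∎
    where open ≡-Reasoning

  H : Graph
  H = extended

  H-symmetric : Symmetric H
  H-symmetric = symmetric-extended balanced

  module Corona = CoronaExtension G

  free-corona : ∀ S → isIndependent G S ≡ true → ∣ Corona.free S ∣ ≡ ∣ free S ∣ + length L
  free-corona S S-indep = +-cancelʳ-≡ (∣ S ∣ + ∣ S ∣) _ _ (begin
      ∣ Corona.free S ∣ + (∣ S ∣ + ∣ S ∣)
    ≡⟨ ≡-sym (+-assoc (∣ Corona.free S ∣) (∣ S ∣) (∣ S ∣)) ⟩
      ∣ Corona.free S ∣ + ∣ S ∣ + ∣ S ∣
    ≡⟨ Corona.free-balance Corona.balanced S S-indep ⟩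
      m + m
    ≡⟨ ≡-sym new-count ⟩
      length newNeighbourhoods + length L
    ≡⟨ cong (_+ length L) (≡-sym (free-balance balanced S S-indep)) ⟩
      ∣ free S ∣ + ∣ S ∣ + ∣ S ∣ + length L
    ≡⟨ rearrange (∣ free S ∣) (∣ S ∣) (length L) ⟩
      ∣ free S ∣ + length L + (∣ S ∣ + ∣ S ∣)
    ∎)
    where
    open ≡-Reasoning
    rearrange : ∀ f s l → f + s + s + l ≡ f + l + (s + s)
    rearrange = solve-∀

  corona-factorization : ∀ j → indPoly (corona2K1 G) j ≡ (onePlusXPow (length L) ⊛ indPoly H) j
  corona-factorization j = begin
      indCoeff (corona2K1 G) j
    ≡⟨ Corona.indCoeff-extended j ⟩
      combination (subsets m) (𝟙 ∘ isIndependent G) (∣_∣ ∘ Corona.free) ∣_∣ j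
    ≡⟨ ⊛-factor (subsets m) (isIndependent G) (∣_∣ ∘ Corona.free) (∣_∣ ∘ free) ∣_∣ (length L)
                free-corona j ⟩
      (onePlusXPow (length L) ⊛ combination (subsets m) (𝟙 ∘ isIndependent G) (∣_∣ ∘ free) ∣_∣) j
    ≡⟨ ⊛-congʳ (onePlusXPow (length L)) (≡-sym ∘ indCoeff-extended) j ⟩
      (onePlusXPow (length L) ⊛ indCoeff H) j
    ∎
    where open ≡-Reasoning

unique-++ˡ : ∀ (xs ys : List A) → Unique (xs ++ ys) → Unique xs
unique-++ˡ []       ys _                 = []
unique-++ˡ (x ∷ xs) ys (x∉xs++ys ∷ uniq) = All.++⁻ˡ xs x∉xs++ys ∷ unique-++ˡ xs ys uniq

matching-take : ∀ (G : Graph) k M → IsMatching G M → IsMatching G (take k M)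
matching-take G k M (M-edges , M-unique) =
  All.take⁺ k M-edges , unique-++ˡ (endpoints (take k M)) (endpoints (drop k M)) (subst Unique split M-unique)
  where
  split : endpoints M ≡ endpoints (take k M) ++ endpoints (drop k M)
  split = trans (cong endpoints (≡-sym (take++drop≡id k M))) (concatMap-++ _ (take k M) (drop k M))

theorem11 : (G : Graph) (k m : ℕ) → IsMatchingNumber G m → k ≤ m →
    Σ Graph (λ H → (G ⊆G H) × Symmetric H ×
      (∀ j → indPoly (corona2K1 G) j ≡ (onePlusXPow k ⊛ indPoly H) j))
theorem11 G k m ((M , M-matching , |M|≡m) , _) k≤m =
  H , G⊆extended , H-symmetric ,
  subst (λ l → ∀ j → indPoly (corona2K1 G) j ≡ (onePlusXPow l ⊛ indPoly H) j) |L|≡k corona-factorization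
  where
  L = take k M
  open Padding G L (matching-take G k M M-matching)
  |L|≡k : length L ≡ k
  |L|≡k = trans (length-take k M) (trans (cong (k ⊓_) |M|≡m) (m≤n⇒m⊓n≡m k≤m))
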